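{- Let $n$ be a composite integer, let $k$ be a divisor of $n$ with $2\le k\le n-1$, and let $m$ be a divisor of $n/k$ with $2\le m\le n/k-1$. Let $D=\{d\in D_n\mid k\nmid d\}\cup kmD_{n/(km)}$, where $kmD_{n/(km)}=\{km\,\delta\mid \delta\in D_{n/(km)}\}$. Then the adjacency spectrum of the integral circulant graph $\mathrm{ICG}_n(D)$ contains exactly four distinct eigenvalues.
   Context: For a positive integer $r$, $D_r$ denotes the set of positive divisors of $r$ other than $r$ itself. For $D\subseteq D_n$, the integral circulant graph $\mathrm{ICG}_n(D)$ is the graph on $\mathbb{Z}_n=\{0,\ldots,n-1\}$ in which $i$ and $j$ are adjacent iff $\gcd(i-j,n)\in D$. -}

module Defs where

open import Data.Nat as ℕ using (ℕ; zero; suc; _∸_; ∣_-_∣)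
open import Data.Nat.Divisibility using (_∣?_; _∣_)
open import Data.Nat.GCD using (gcd)
open import Data.Integer as ℤ using (ℤ; _-_; _*_; _+_; 0ℤ; 1ℤ)
open import Data.Fin using (Fin; toℕ)
open import Data.Fin.Base as Fin using ()
open import Data.List using (List; filter; map; upTo; _++_)
open import Data.List.Membership.DecPropositional ℕ._≟_ using (_∈?_)
open import Data.Bool using (if_then_else_)
open import Data.Product using (∃; _×_)
open import Relation.Nullary using (¬_; does; ¬?)
open import Relation.Binary.PropositionalEquality using (_≡_; _≢_)

Dlist : ℕ → List ℕ
Dlist r = filter (λ d → d ∣? r) (map suc (upTo (r ∸ 1)))

-- The divisor set of Theorem 4.5, for n = k * q and q = m * r (so q = n/k, r = n/(km)):
-- D = {d ∈ D_n | k ∤ d} ∪ km D_{n/(km)}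
Dthm : (n k m r : ℕ) → List ℕ
Dthm n k m r = filter (λ d → ¬? (k ∣? d)) (Dlist n) ++ map (λ δ → k ℕ.* m ℕ.* δ) (Dlist r)

Matrix : ℕ → Set
Matrix n = Fin n → Fin n → ℤ

Vector : ℕ → Set
Vector n = Fin n → ℤ

sumFin : (n : ℕ) → (Fin n → ℤ) → ℤ
sumFin zero    f = 0ℤ
sumFin (suc n) f = f Fin.zero + sumFin n (λ i → f (Fin.suc i))

_·_ : {n : ℕ} → Matrix n → Matrix n → Matrix n
_·_ {n} A B i j = sumFin n (λ l → A i l * B l j)

apply : {n : ℕ} → Matrix n → Vector n → Vector n
apply {n} A x i = sumFin n (λ l → A i l * x l)

identity : {n : ℕ} → Matrix n
identity i j = if does (toℕ i ℕ.≟ toℕ j) then 1ℤ else 0ℤ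

shift : {n : ℕ} → Matrix n → ℤ → Matrix n
shift A λ' i j = A i j - λ' * identity i j

IsZeroMatrix : {n : ℕ} → Matrix n → Set
IsZeroMatrix A = ∀ i j → A i j ≡ 0ℤ

IsEigenvalue : {n : ℕ} → Matrix n → ℤ → Set
IsEigenvalue {n} A λ' = ∃ λ (x : Vector n) → (∃ λ i → x i ≢ 0ℤ) × (∀ i → apply A x i ≡ λ' * x i)

-- adjacency matrix of ICG_n(D): i ~ j iff gcd(i - j, n) ∈ D
-- (gcd(i - j, n) for i, j ∈ ℤ_n equals gcd(|i - j|, n) computed on representatives)
ICGadj : (n : ℕ) → List ℕ → Matrix n
ICGadj n D i j = if does (gcd ∣ toℕ i - toℕ j ∣ n ∈? D) then 1ℤ else 0ℤ

-- A matrix (real symmetric, hence diagonalizable) has exactly four distinct eigenvalues: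
-- four pairwise distinct values, each an eigenvalue, and (A-λ₁)(A-λ₂)(A-λ₃)(A-λ₄) = 0,
-- so that every (complex) eigenvalue is one of λ₁,…,λ₄.
HasExactlyFourEigenvalues : {n : ℕ} → Matrix n → Set
HasExactlyFourEigenvalues A =
  ∃ λ l₁ → ∃ λ l₂ → ∃ λ l₃ → ∃ λ l₄ →
    (l₁ ≢ l₂) × (l₁ ≢ l₃) × (l₁ ≢ l₄) × (l₂ ≢ l₃) × (l₂ ≢ l₄) × (l₃ ≢ l₄) ×
    IsEigenvalue A l₁ × IsEigenvalue A l₂ × IsEigenvalue A l₃ × IsEigenvalue A l₄ ×
    IsZeroMatrix (((shift A l₁ · shift A l₂) · shift A l₃) · shift A l₄)

-- Write χ d for the 0/1 matrix of the relation i ≡ j (mod d), so that χ 1 = J and χ n = I.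
-- Since gcd(i − j, n) ∈ D exactly when k ∤ i − j or km ∣ i − j, the adjacency matrix is
-- A = χ 1 − χ k + χ km − χ n.  For a divisor chain d₁ ∣ d₂ ∣ ⋯ of n one has χ d · χ e = (n/e) χ d
-- whenever d ∣ e, so the combinations Σ cᵢ χ dᵢ form a commutative algebra.  It is diagonalised by
-- the injective, multiplicative map sending Σ cᵢ χ dᵢ to its vector of suffix sums Σ_{j ≥ i} c_j n/d_j,
-- the eigenvalues on the successive eigenspaces.  For A this vector lists the four distinct numbers
-- n − n/k + n/km − 1, n/km − n/k − 1, n/km − 1 and −1; hence the product of the four shifted matrices
-- has zero spectrum and vanishes, while each eigenvalue is attained on a combination whose spectrum
-- is concentrated in the corresponding coordinate.
module Submission where

open import Defs

module ICGSpectrum where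

  open import Data.Nat as ℕ using (ℕ; zero; suc; _≤_; _<_; _∸_; z≤n; s≤s; z<s; NonZero; ∣_-_∣)
  import Data.Nat.Properties as ℕP
  open import Data.Nat.Divisibility
    using ( _∣_; _∣?_; divides; quotient; quotient≢0; ∣-refl; ∣-trans; _∣0; 1∣_; 0∣⇒≡0; ∣m⇒∣m*n
          ; ∣⇒≤; *-cancelˡ-∣)
  open import Data.Nat.DivMod
    using (_%_; _/_; m≡m%n+[m/n]*n; %-remove-+ˡ; %-remove-+ʳ; m<n⇒m%n≡m; m%n<n; m%n%n≡m%n)
  open import Data.Nat.GCD using (gcd; gcd[m,n]∣m; gcd[m,n]∣n; gcd-greatest; gcd[m,n]≢0; gcd-identityˡ)
  open import Data.Integer as ℤ using (ℤ; +_; 0ℤ; 1ℤ; _+_; _*_; _-_; -_)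
  import Data.Integer.Properties as ℤP
  open import Data.Integer.Tactic.RingSolver using (solve-∀)
  open import Algebra.Properties.AbelianGroup ℤP.+-0-abelianGroup using (∙-cancelʳ)
  open import Algebra.Properties.Semiring.Sum ℤP.+-*-semiring
    using (sum; sum-syntax; sum-cong-≗; sum-remove; sum-replicate-zero; ∑-distrib-+; *-distribˡ-sum)
  open import Data.Fin as Fin using (Fin; toℕ; fromℕ<; punchIn)
  open import Data.Fin.Properties using (toℕ<n; toℕ-fromℕ<; toℕ-injective; punchInᵢ≢i)
  open import Data.List as List using (List; filter; upTo)
  open import Data.List.Membership.Propositional using (_∈_; _∉_)
  open import Data.List.Membership.Propositional.Properties
    using (∈-filter⁺; ∈-filter⁻; ∈-map⁺; ∈-map⁻; ∈-++⁺ˡ; ∈-++⁺ʳ; ∈-++⁻; ∈-upTo⁺; ∈-upTo⁻)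
  open import Data.List.Membership.DecPropositional ℕ._≟_ using (_∈?_)
  open import Data.Vec using (Vec; []; _∷_; map; zipWith)
  open import Data.Vec.Properties using (∷-injectiveˡ; ∷-injectiveʳ; map-cong; map-id)
  open import Data.Vec.Relation.Unary.All using (All; []; _∷_)
  open import Data.Vec.Relation.Unary.AllPairs using (AllPairs; []; _∷_)
  open import Data.Vec.Relation.Binary.Pointwise.Inductive using (Pointwise; []; _∷_)
  open import Data.Bool using (if_then_else_; true; false)
  open import Data.Empty using (⊥-elim)
  open import Data.Product using (_,_; _×_; proj₁; proj₂)
  open import Data.Sum using (_⊎_; inj₁; inj₂)
  open import Function using (_∘_)
  open import Relation.Nullary using (¬_; ¬?; does; yes; no)
  open import Relation.Nullary.Decidable using (dec-true; dec-false)
  open import Relation.Binary.PropositionalEquality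

  Kernel : Set
  Kernel = ℕ → ℕ → ℤ

  Symmetric : Kernel → Set
  Symmetric f = ∀ a b → f a b ≡ f b a

  χ : ℕ → Kernel
  χ d a b = if does (d ∣? ∣ a - b ∣) then 1ℤ else 0ℤ

  χ-yes : ∀ {d} a b → d ∣ ∣ a - b ∣ → χ d a b ≡ 1ℤ
  χ-yes {d} a b d∣ rewrite dec-true (d ∣? ∣ a - b ∣) d∣ = refl

  χ-no : ∀ {d} a b → ¬ d ∣ ∣ a - b ∣ → χ d a b ≡ 0ℤ
  χ-no {d} a b d∤ rewrite dec-false (d ∣? ∣ a - b ∣) d∤ = refl

  χ-sym : ∀ d → Symmetric (χ d)
  χ-sym d a b = cong (λ s → if does (d ∣? s) then 1ℤ else 0ℤ) (ℕP.∣-∣-comm a b)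

  χ-refl : ∀ d a → χ d a a ≡ 1ℤ
  χ-refl d a = χ-yes a a (subst (d ∣_) (sym (ℕP.∣n-n∣≡0 a)) (d ∣0))

  m≢n⇒0<∣m-n∣ : ∀ {m n} → m ≢ n → 0 < ∣ m - n ∣
  m≢n⇒0<∣m-n∣ m≢n = ℕP.n≢0⇒n>0 (m≢n ∘ ℕP.∣m-n∣≡0⇒m≡n)

  ∣m-n∣<o : ∀ {m n o} → m < o → n < o → ∣ m - n ∣ < o
  ∣m-n∣<o {m} {n} m<o n<o = ℕP.≤-<-trans (ℕP.∣m-n∣≤m⊔n m n) (ℕP.⊔-lub m<o n<o)

  χ-≢ : ∀ {n a b} → a < n → b < n → a ≢ b → χ n a b ≡ 0ℤ
  χ-≢ {a = a} {b} a<n b<n a≢b = χ-no a b λ n∣ →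
    ℕP.<⇒≱ (∣m-n∣<o a<n b<n) (∣⇒≤ {{ℕ.>-nonZero (m≢n⇒0<∣m-n∣ a≢b)}} n∣)

  module _ (d : ℕ) .{{_ : NonZero d}} where

    private
      ∣∸⇒%≡ : ∀ {a b} → b ≤ a → d ∣ a ∸ b → a % d ≡ b % d
      ∣∸⇒%≡ {a} {b} b≤a d∣ = begin
        a % d               ≡⟨ cong (_% d) (ℕP.m+[n∸m]≡n b≤a) ⟨
        (b ℕ.+ (a ∸ b)) % d ≡⟨ %-remove-+ʳ b d∣ ⟩
        b % d               ∎
        where open ≡-Reasoning

      %≡⇒∣∸ : ∀ {a b} → b ≤ a → a % d ≡ b % d → d ∣ a ∸ b
      %≡⇒∣∸ {a} {b} b≤a eq = divides (a / d ∸ b / d) (begin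
        a ∸ b                                             ≡⟨ cong₂ _∸_ (m≡m%n+[m/n]*n a d) (m≡m%n+[m/n]*n b d) ⟩
        (a % d ℕ.+ a / d ℕ.* d) ∸ (b % d ℕ.+ b / d ℕ.* d) ≡⟨ cong (λ x → (x ℕ.+ a / d ℕ.* d) ∸ (b % d ℕ.+ b / d ℕ.* d)) eq ⟩
        (b % d ℕ.+ a / d ℕ.* d) ∸ (b % d ℕ.+ b / d ℕ.* d) ≡⟨ ℕP.[m+n]∸[m+o]≡n∸o (b % d) _ _ ⟩
        a / d ℕ.* d ∸ b / d ℕ.* d                         ≡⟨ ℕP.*-distribʳ-∸ d (a / d) (b / d) ⟨
        (a / d ∸ b / d) ℕ.* d                             ∎)
        where open ≡-Reasoning

    ∣∣m-n∣⇒%≡ : ∀ a b → d ∣ ∣ a - b ∣ → a % d ≡ b % d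
    ∣∣m-n∣⇒%≡ a b d∣ with ℕP.≤-total b a
    ... | inj₁ b≤a = ∣∸⇒%≡ b≤a (subst (d ∣_) (ℕP.m≤n⇒∣n-m∣≡n∸m b≤a) d∣)
    ... | inj₂ a≤b = sym (∣∸⇒%≡ a≤b (subst (d ∣_) (ℕP.m≤n⇒∣m-n∣≡n∸m a≤b) d∣))

    %≡⇒∣∣m-n∣ : ∀ a b → a % d ≡ b % d → d ∣ ∣ a - b ∣
    %≡⇒∣∣m-n∣ a b eq with ℕP.≤-total b a
    ... | inj₁ b≤a = subst (d ∣_) (sym (ℕP.m≤n⇒∣n-m∣≡n∸m b≤a)) (%≡⇒∣∸ b≤a eq)
    ... | inj₂ a≤b = subst (d ∣_) (sym (ℕP.m≤n⇒∣m-n∣≡n∸m a≤b)) (%≡⇒∣∸ a≤b (sym eq))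

    χ-cong-% : ∀ {a a'} b → a % d ≡ a' % d → χ d a b ≡ χ d a' b
    χ-cong-% {a} {a'} b eq with d ∣? ∣ a - b ∣ | d ∣? ∣ a' - b ∣
    ... | yes _  | yes _  = refl
    ... | no _   | no _   = refl
    ... | yes d∣ | no d∤  = ⊥-elim (d∤ (%≡⇒∣∣m-n∣ a' b (trans (sym eq) (∣∣m-n∣⇒%≡ a b d∣))))
    ... | no d∤  | yes d∣ = ⊥-elim (d∤ (%≡⇒∣∣m-n∣ a b (trans eq (∣∣m-n∣⇒%≡ a' b d∣))))

  ∑-split : ∀ e c (f : ℕ → ℤ) →
            ∑[ l < e ℕ.+ c ] f (toℕ l) ≡ ∑[ l < e ] f (toℕ l) + ∑[ l < c ] f (e ℕ.+ toℕ l)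
  ∑-split zero    c f = sym (ℤP.+-identityˡ _)
  ∑-split (suc e) c f = trans (cong (λ x → f 0 + x) (∑-split e c (f ∘ suc))) (sym (ℤP.+-assoc (f 0) _ _))

  ∑-indicator : ∀ {N} (i : Fin N) (t : Fin N → ℤ) →
                t i ≡ 1ℤ → (∀ j → j ≢ i → t j ≡ 0ℤ) → sum t ≡ 1ℤ
  ∑-indicator {suc N} i t tᵢ≡1 t≡0 = begin
    sum t                              ≡⟨ sum-remove {i = i} t ⟩
    t i + sum (λ j → t (punchIn i j))  ≡⟨ cong₂ _+_ tᵢ≡1 (sum-cong-≗ (λ j → t≡0 _ (punchInᵢ≢i i j))) ⟩
    1ℤ + sum {N} (λ _ → 0ℤ)            ≡⟨ cong (λ x → 1ℤ + x) (sum-replicate-zero N) ⟩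
    1ℤ                                 ∎
    where open ≡-Reasoning

  sumFin≡sum : ∀ N (f : Fin N → ℤ) → sumFin N f ≡ sum f
  sumFin≡sum zero    f = refl
  sumFin≡sum (suc N) f = cong (λ x → f Fin.zero + x) (sumFin≡sum N (f ∘ Fin.suc))

  module _ (e : ℕ) .{{_ : NonZero e}} where

    ∑-χ-period : ∀ b → ∑[ l < e ] χ e (toℕ l) b ≡ 1ℤ
    ∑-χ-period b = ∑-indicator i₀ (λ l → χ e (toℕ l) b) hit miss
      where
        i₀ : Fin e
        i₀ = fromℕ< (m%n<n b e)
        hit : χ e (toℕ i₀) b ≡ 1ℤ
        hit = trans (χ-cong-% e b (trans (cong (_% e) (toℕ-fromℕ< _)) (m%n%n≡m%n b e))) (χ-refl e b)
        miss : ∀ j → j ≢ i₀ → χ e (toℕ j) b ≡ 0ℤ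
        miss j j≢i₀ = χ-no (toℕ j) b λ e∣ → j≢i₀ (toℕ-injective (begin
          toℕ j      ≡⟨ m<n⇒m%n≡m (toℕ<n j) ⟨
          toℕ j % e  ≡⟨ ∣∣m-n∣⇒%≡ e (toℕ j) b e∣ ⟩
          b % e      ≡⟨ toℕ-fromℕ< _ ⟨
          toℕ i₀     ∎))
          where open ≡-Reasoning

    ∑-χ-periods : ∀ c b → ∑[ l < c ℕ.* e ] χ e (toℕ l) b ≡ + c
    ∑-χ-periods zero    b = refl
    ∑-χ-periods (suc c) b = begin
      ∑[ l < e ℕ.+ c ℕ.* e ] χ e (toℕ l) b
        ≡⟨ ∑-split e (c ℕ.* e) (λ l → χ e l b) ⟩
      ∑[ l < e ] χ e (toℕ l) b + ∑[ l < c ℕ.* e ] χ e (e ℕ.+ toℕ l) b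
        ≡⟨ cong₂ _+_ (∑-χ-period b) (sum-cong-≗ {c ℕ.* e} periodic) ⟩
      1ℤ + ∑[ l < c ℕ.* e ] χ e (toℕ l) b
        ≡⟨ cong (λ x → 1ℤ + x) (∑-χ-periods c b) ⟩
      + suc c ∎
      where
        open ≡-Reasoning
        periodic : ∀ l → χ e (e ℕ.+ toℕ l) b ≡ χ e (toℕ l) b
        periodic l = χ-cong-% e b (%-remove-+ˡ (toℕ l) ∣-refl)

  ⟦_⟧ : ∀ {p} → Vec ℕ p → Vec ℤ p → Kernel
  ⟦ []     ⟧ []       a b = 0ℤ
  ⟦ d ∷ ds ⟧ (c ∷ cs) a b = c * χ d a b + ⟦ ds ⟧ cs a b

  ⟦⟧-sym : ∀ {p} (ds : Vec ℕ p) cs → Symmetric (⟦ ds ⟧ cs)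
  ⟦⟧-sym []       []       a b = refl
  ⟦⟧-sym (d ∷ ds) (c ∷ cs) a b = cong₂ (λ x y → c * x + y) (χ-sym d a b) (⟦⟧-sym ds cs a b)

  ⟦⟧-scale : ∀ {p} (ds : Vec ℕ p) x cs a b → ⟦ ds ⟧ (map (x *_) cs) a b ≡ x * ⟦ ds ⟧ cs a b
  ⟦⟧-scale []       x []       a b = sym (ℤP.*-zeroʳ x)
  ⟦⟧-scale (d ∷ ds) x (c ∷ cs) a b =
    trans (cong (λ y → x * c * χ d a b + y) (⟦⟧-scale ds x cs a b)) (distrib x c (χ d a b) _)
    where
      distrib : ∀ x c y z → x * c * y + x * z ≡ x * (c * y + z)
      distrib = solve-∀

  zipWith-*-supported : ∀ {p} x {σ v : Vec ℤ p} → Pointwise (λ σᵢ vᵢ → σᵢ ≡ x ⊎ vᵢ ≡ 0ℤ) σ v →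
                        zipWith _*_ σ v ≡ map (x *_) v
  zipWith-*-supported x []                 = refl
  zipWith-*-supported x (inj₁ refl ∷ rest) = cong (_ ∷_) (zipWith-*-supported x rest)
  zipWith-*-supported x {σᵢ ∷ _} (inj₂ refl ∷ rest) =
    cong₂ _∷_ (trans (ℤP.*-zeroʳ σᵢ) (sym (ℤP.*-zeroʳ x))) (zipWith-*-supported x rest)

  root-of-∏ : ∀ y a b c d → y ≡ a ⊎ y ≡ b ⊎ y ≡ c ⊎ y ≡ d → (y - a) * (y - b) * (y - c) * (y - d) ≡ 0ℤ
  root-of-∏ y _ b c d (inj₁ refl) = cong (λ u → u * (y - b) * (y - c) * (y - d)) (ℤP.+-inverseʳ y)
  root-of-∏ y a _ c d (inj₂ (inj₁ refl)) =
    cong (λ u → u * (y - c) * (y - d)) (trans (cong ((y - a) *_) (ℤP.+-inverseʳ y)) (ℤP.*-zeroʳ (y - a)))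
  root-of-∏ y a b _ d (inj₂ (inj₂ (inj₁ refl))) =
    cong (_* (y - d)) (trans (cong ((y - a) * (y - b) *_) (ℤP.+-inverseʳ y)) (ℤP.*-zeroʳ ((y - a) * (y - b))))
  root-of-∏ y a b c _ (inj₂ (inj₂ (inj₂ refl))) =
    trans (cong ((y - a) * (y - b) * (y - c) *_) (ℤP.+-inverseʳ y)) (ℤP.*-zeroʳ ((y - a) * (y - b) * (y - c)))

  ≡+suc⇒< : ∀ {x y d} → y ≡ x + + suc d → x ℤ.< y
  ≡+suc⇒< {x} {y} y≡x+d = subst (ℤ._< y) (ℤP.+-identityʳ x)
    (subst (x + 0ℤ ℤ.<_) (sym y≡x+d) (ℤP.+-monoʳ-< x (ℤ.+<+ z<s)))

  module KernelAlgebra (n : ℕ) .{{_ : NonZero n}} where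

    infixl 7 _⋆_
    _⋆_ : Kernel → Kernel → Kernel
    (f ⋆ g) a b = ∑[ l < n ] (f a (toℕ l) * g (toℕ l) b)

    ⋆-linearˡ : ∀ c (f g h : Kernel) a b →
                ((λ x y → c * f x y + g x y) ⋆ h) a b ≡ c * (f ⋆ h) a b + (g ⋆ h) a b
    ⋆-linearˡ c f g h a b = begin
      ∑[ l < n ] ((c * f a (toℕ l) + g a (toℕ l)) * h (toℕ l) b)
        ≡⟨ sum-cong-≗ {n} (λ l → distrib c (f a (toℕ l)) (g a (toℕ l)) (h (toℕ l) b)) ⟩
      ∑[ l < n ] (c * (f a (toℕ l) * h (toℕ l) b) + g a (toℕ l) * h (toℕ l) b)
        ≡⟨ ∑-distrib-+ {n} (λ l → c * (f a (toℕ l) * h (toℕ l) b)) _ ⟩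
      ∑[ l < n ] (c * (f a (toℕ l) * h (toℕ l) b)) + (g ⋆ h) a b
        ≡⟨ cong (_+ (g ⋆ h) a b) (*-distribˡ-sum {n} c _) ⟨
      c * (f ⋆ h) a b + (g ⋆ h) a b ∎
      where
        open ≡-Reasoning
        distrib : ∀ c x y z → (c * x + y) * z ≡ c * (x * z) + y * z
        distrib = solve-∀

    ⋆-linearʳ : ∀ c (f g h : Kernel) a b →
                (f ⋆ (λ x y → c * g x y + h x y)) a b ≡ c * (f ⋆ g) a b + (f ⋆ h) a b
    ⋆-linearʳ c f g h a b = begin
      ∑[ l < n ] (f a (toℕ l) * (c * g (toℕ l) b + h (toℕ l) b))
        ≡⟨ sum-cong-≗ {n} (λ l → distrib c (f a (toℕ l)) (g (toℕ l) b) (h (toℕ l) b)) ⟩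
      ∑[ l < n ] (c * (f a (toℕ l) * g (toℕ l) b) + f a (toℕ l) * h (toℕ l) b)
        ≡⟨ ∑-distrib-+ {n} (λ l → c * (f a (toℕ l) * g (toℕ l) b)) _ ⟩
      ∑[ l < n ] (c * (f a (toℕ l) * g (toℕ l) b)) + (f ⋆ h) a b
        ≡⟨ cong (_+ (f ⋆ h) a b) (*-distribˡ-sum {n} c _) ⟨
      c * (f ⋆ g) a b + (f ⋆ h) a b ∎
      where
        open ≡-Reasoning
        distrib : ∀ c x y z → x * (c * y + z) ≡ c * (x * y) + x * z
        distrib = solve-∀

    ⋆-zeroʳ : ∀ (f : Kernel) a b → (f ⋆ (λ _ _ → 0ℤ)) a b ≡ 0ℤ
    ⋆-zeroʳ f a b = trans (sum-cong-≗ {n} (λ l → ℤP.*-zeroʳ (f a (toℕ l)))) (sum-replicate-zero n)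

    ⋆-transpose : ∀ {f g} → Symmetric f → Symmetric g → ∀ a b → (f ⋆ g) a b ≡ (g ⋆ f) b a
    ⋆-transpose {f} {g} f-sym g-sym a b = sum-cong-≗ {n} λ l →
      trans (cong₂ _*_ (f-sym a (toℕ l)) (g-sym (toℕ l) b)) (ℤP.*-comm (f (toℕ l) a) (g b (toℕ l)))

    ∣n⇒nonZero : ∀ {d} → d ∣ n → NonZero d
    ∣n⇒nonZero {zero}  0∣n = ⊥-elim (ℕ.≢-nonZero⁻¹ n (0∣⇒≡0 0∣n))
    ∣n⇒nonZero {suc d} _   = _

    ∑-χ : ∀ {e} (e∣n : e ∣ n) b → ∑[ l < n ] χ e (toℕ l) b ≡ + quotient e∣n
    ∑-χ {e} e∣n@(divides c n≡c*e) b =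
      subst (λ N → ∑[ l < N ] χ e (toℕ l) b ≡ + c) (sym n≡c*e) (∑-χ-periods e {{∣n⇒nonZero e∣n}} c b)

    χ⋆χ : ∀ {d e} → d ∣ e → (e∣n : e ∣ n) → ∀ a b → (χ d ⋆ χ e) a b ≡ + quotient e∣n * χ d a b
    χ⋆χ {d} {e} d∣e e∣n a b = begin
      ∑[ l < n ] (χ d a (toℕ l) * χ e (toℕ l) b) ≡⟨ sum-cong-≗ {n} (λ l → transfer (toℕ l)) ⟩
      ∑[ l < n ] (χ d a b * χ e (toℕ l) b)       ≡⟨ *-distribˡ-sum {n} (χ d a b) _ ⟨
      χ d a b * ∑[ l < n ] χ e (toℕ l) b         ≡⟨ cong (χ d a b *_) (∑-χ e∣n b) ⟩
      χ d a b * + quotient e∣n                   ≡⟨ ℤP.*-comm (χ d a b) _ ⟩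
      + quotient e∣n * χ d a b                   ∎
      where
        open ≡-Reasoning
        instance
          _ : NonZero d
          _ = ∣n⇒nonZero (∣-trans d∣e e∣n)
        transfer : ∀ l → χ d a l * χ e l b ≡ χ d a b * χ e l b
        transfer l with e ∣? ∣ l - b ∣
        ... | yes e∣ = cong (_* 1ℤ) (begin
          χ d a l ≡⟨ χ-sym d a l ⟩
          χ d l a ≡⟨ χ-cong-% d a (∣∣m-n∣⇒%≡ d l b (∣-trans d∣e e∣)) ⟩
          χ d b a ≡⟨ χ-sym d b a ⟩
          χ d a b ∎)
        ... | no _ = trans (ℤP.*-zeroʳ (χ d a l)) (sym (ℤP.*-zeroʳ (χ d a b)))

    -- degree is the row sum of ⟦ ds ⟧ t, i.e. its eigenvalue on the constant vectors; the weight of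
    -- a divisor d is n/d, the quotient of its proof of d ∣ n.
    degree : ∀ {p} {ds : Vec ℕ p} → All (_∣ n) ds → Vec ℤ p → ℤ
    degree []         []       = 0ℤ
    degree (d∣n ∷ ps) (c ∷ cs) = c * + quotient d∣n + degree ps cs

    spectrum : ∀ {p} {ds : Vec ℕ p} → All (_∣ n) ds → Vec ℤ p → Vec ℤ p
    spectrum []         []       = []
    spectrum (d∣n ∷ ps) (c ∷ cs) = degree (d∣n ∷ ps) (c ∷ cs) ∷ spectrum ps cs

    -- When d divides the later divisors, χ d ⋆ χ e = (n/e) χ d and χ e ⋆ χ d = (n/e) χ d, so the
    -- coefficient of χ d in a product collects c·degree(e ∷ es) and degree(cs)·e.
    infixl 7 _⊗⟨_⟩_
    _⊗⟨_⟩_ : ∀ {p} {ds : Vec ℕ p} → Vec ℤ p → All (_∣ n) ds → Vec ℤ p → Vec ℤ p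
    []       ⊗⟨ []         ⟩ []       = []
    (c ∷ cs) ⊗⟨ d∣n ∷ ps ⟩ (e ∷ es) = c * degree (d∣n ∷ ps) (e ∷ es) + degree ps cs * e ∷ cs ⊗⟨ ps ⟩ es

    χ⋆⟦⟧ : ∀ {p d} {ds : Vec ℕ p} → All (d ∣_) ds → (ps : All (_∣ n) ds) → ∀ s a b →
           (χ d ⋆ ⟦ ds ⟧ s) a b ≡ degree ps s * χ d a b
    χ⋆⟦⟧ {d = d} []              []          []       a b = ⋆-zeroʳ (χ d) a b
    χ⋆⟦⟧ {d = d} {d' ∷ ds} (d∣d' ∷ d∣ds) (d'∣n ∷ ps) (e ∷ es) a b = begin
      (χ d ⋆ ⟦ d' ∷ ds ⟧ (e ∷ es)) a b
        ≡⟨ ⋆-linearʳ e (χ d) (χ d') (⟦ ds ⟧ es) a b ⟩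
      e * (χ d ⋆ χ d') a b + (χ d ⋆ ⟦ ds ⟧ es) a b
        ≡⟨ cong₂ (λ x y → e * x + y) (χ⋆χ d∣d' d'∣n a b) (χ⋆⟦⟧ d∣ds ps es a b) ⟩
      e * (+ quotient d'∣n * χ d a b) + degree ps es * χ d a b
        ≡⟨ distrib e (+ quotient d'∣n) (χ d a b) (degree ps es) ⟩
      degree (d'∣n ∷ ps) (e ∷ es) * χ d a b ∎
      where
        open ≡-Reasoning
        distrib : ∀ e w x D → e * (w * x) + D * x ≡ (e * w + D) * x
        distrib = solve-∀

    ⟦⟧⋆χ : ∀ {p d} {ds : Vec ℕ p} → All (d ∣_) ds → (ps : All (_∣ n) ds) → ∀ t a b →
           (⟦ ds ⟧ t ⋆ χ d) a b ≡ degree ps t * χ d a b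
    ⟦⟧⋆χ {d = d} {ds} d∣ds ps t a b = begin
      (⟦ ds ⟧ t ⋆ χ d) a b   ≡⟨ ⋆-transpose (⟦⟧-sym ds t) (χ-sym d) a b ⟩
      (χ d ⋆ ⟦ ds ⟧ t) b a   ≡⟨ χ⋆⟦⟧ d∣ds ps t b a ⟩
      degree ps t * χ d b a  ≡⟨ cong (degree ps t *_) (χ-sym d b a) ⟩
      degree ps t * χ d a b  ∎
      where open ≡-Reasoning

    ⟦⟧⋆⟦⟧ : ∀ {p} {ds : Vec ℕ p} → AllPairs _∣_ ds → (ps : All (_∣ n) ds) → ∀ t s a b →
            (⟦ ds ⟧ t ⋆ ⟦ ds ⟧ s) a b ≡ ⟦ ds ⟧ (t ⊗⟨ ps ⟩ s) a b
    ⟦⟧⋆⟦⟧ [] [] [] [] a b = ⋆-zeroʳ (λ _ _ → 0ℤ) a b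
    ⟦⟧⋆⟦⟧ {ds = d ∷ ds} (d∣ds ∷ chain) (d∣n ∷ ps) (c ∷ cs) (e ∷ es) a b = begin
      (⟦ d ∷ ds ⟧ (c ∷ cs) ⋆ ⟦ d ∷ ds ⟧ (e ∷ es)) a b
        ≡⟨ ⋆-linearˡ c (χ d) (⟦ ds ⟧ cs) (⟦ d ∷ ds ⟧ (e ∷ es)) a b ⟩
      c * (χ d ⋆ ⟦ d ∷ ds ⟧ (e ∷ es)) a b + (⟦ ds ⟧ cs ⋆ ⟦ d ∷ ds ⟧ (e ∷ es)) a b
        ≡⟨ cong₂ (λ x y → c * x + y) (χ⋆⟦⟧ (∣-refl ∷ d∣ds) (d∣n ∷ ps) (e ∷ es) a b)
                                     (⋆-linearʳ e (⟦ ds ⟧ cs) (χ d) (⟦ ds ⟧ es) a b) ⟩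
      c * (Dₑ * χ d a b) + (e * (⟦ ds ⟧ cs ⋆ χ d) a b + (⟦ ds ⟧ cs ⋆ ⟦ ds ⟧ es) a b)
        ≡⟨ cong₂ (λ x y → c * (Dₑ * χ d a b) + (e * x + y)) (⟦⟧⋆χ d∣ds ps cs a b) (⟦⟧⋆⟦⟧ chain ps cs es a b) ⟩
      c * (Dₑ * χ d a b) + (e * (degree ps cs * χ d a b) + ⟦ ds ⟧ (cs ⊗⟨ ps ⟩ es) a b)
        ≡⟨ distrib c e Dₑ (degree ps cs) (χ d a b) _ ⟩
      ⟦ d ∷ ds ⟧ ((c ∷ cs) ⊗⟨ d∣n ∷ ps ⟩ (e ∷ es)) a b ∎
      where
        open ≡-Reasoning
        Dₑ = degree (d∣n ∷ ps) (e ∷ es)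
        distrib : ∀ c e S T x R → c * (S * x) + (e * (T * x) + R) ≡ (c * S + T * e) * x + R
        distrib = solve-∀

    degree-⊗ : ∀ {p} {ds : Vec ℕ p} (ps : All (_∣ n) ds) t s →
               degree ps (t ⊗⟨ ps ⟩ s) ≡ degree ps t * degree ps s
    degree-⊗ []         []       []       = refl
    degree-⊗ (d∣n ∷ ps) (c ∷ cs) (e ∷ es) =
      trans (cong (λ y → (c * (e * w + S) + T * e) * w + y) (degree-⊗ ps cs es)) (expand c e w S T)
      where
        w = + quotient d∣n
        S = degree ps es
        T = degree ps cs
        expand : ∀ c e w S T → (c * (e * w + S) + T * e) * w + T * S ≡ (c * w + T) * (e * w + S)
        expand = solve-∀

    degree-scale : ∀ {p} {ds : Vec ℕ p} (ps : All (_∣ n) ds) x s → degree ps (map (x *_) s) ≡ x * degree ps s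
    degree-scale []         x []       = sym (ℤP.*-zeroʳ x)
    degree-scale (d∣n ∷ ps) x (c ∷ cs) =
      trans (cong (λ y → x * c * + quotient d∣n + y) (degree-scale ps x cs)) (distrib x c (+ quotient d∣n) _)
      where
        distrib : ∀ x c w D → x * c * w + x * D ≡ x * (c * w + D)
        distrib = solve-∀

    spectrum-⊗ : ∀ {p} {ds : Vec ℕ p} (ps : All (_∣ n) ds) t s →
                 spectrum ps (t ⊗⟨ ps ⟩ s) ≡ zipWith _*_ (spectrum ps t) (spectrum ps s)
    spectrum-⊗ []         []       []       = refl
    spectrum-⊗ (d∣n ∷ ps) (c ∷ cs) (e ∷ es) =
      cong₂ _∷_ (degree-⊗ (d∣n ∷ ps) (c ∷ cs) (e ∷ es)) (spectrum-⊗ ps cs es)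

    spectrum-scale : ∀ {p} {ds : Vec ℕ p} (ps : All (_∣ n) ds) x s →
                     spectrum ps (map (x *_) s) ≡ map (x *_) (spectrum ps s)
    spectrum-scale []         x []       = refl
    spectrum-scale (d∣n ∷ ps) x (c ∷ cs) =
      cong₂ _∷_ (degree-scale (d∣n ∷ ps) x (c ∷ cs)) (spectrum-scale ps x cs)

    spectrum-injective : ∀ {p} {ds : Vec ℕ p} (ps : All (_∣ n) ds) {t s} →
                         spectrum ps t ≡ spectrum ps s → t ≡ s
    spectrum-injective []         {[]}     {[]}     _  = refl
    spectrum-injective (d∣n ∷ ps) {c ∷ cs} {e ∷ es} eq = cong₂ _∷_ c≡e cs≡es
      where
        instance _ = quotient≢0 d∣n
        cs≡es : cs ≡ es
        cs≡es = spectrum-injective ps (∷-injectiveʳ eq)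
        c≡e : c ≡ e
        c≡e = ℤP.*-cancelʳ-≡ c e (+ quotient d∣n) (∙-cancelʳ (degree ps es) _ _
                (trans (cong (λ x → c * + quotient d∣n + degree ps x) (sym cs≡es)) (∷-injectiveˡ eq)))

    ⊗-eigenvector : ∀ {p} {ds : Vec ℕ p} (ps : All (_∣ n) ds) x {t s} →
                    zipWith _*_ (spectrum ps t) (spectrum ps s) ≡ map (x *_) (spectrum ps s) →
                    t ⊗⟨ ps ⟩ s ≡ map (x *_) s
    ⊗-eigenvector ps x {t} {s} eq =
      spectrum-injective ps (trans (spectrum-⊗ ps t s) (trans eq (sym (spectrum-scale ps x s))))

    Represents : Matrix n → Kernel → Set
    Represents A f = ∀ i j → A i j ≡ f (toℕ i) (toℕ j)

    Represents-· : ∀ {A B f g} → Represents A f → Represents B g → Represents (A · B) (f ⋆ g)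
    Represents-· A≈f B≈g i j = trans (sumFin≡sum n _) (sum-cong-≗ {n} (λ l → cong₂ _*_ (A≈f i l) (B≈g l j)))

    Represents-⊗ : ∀ {p} {ds : Vec ℕ p} → AllPairs _∣_ ds → (ps : All (_∣ n) ds) → ∀ {A B} t s →
                   Represents A (⟦ ds ⟧ t) → Represents B (⟦ ds ⟧ s) → Represents (A · B) (⟦ ds ⟧ (t ⊗⟨ ps ⟩ s))
    Represents-⊗ {ds = ds} chain ps t s A≈t B≈s i j =
      trans (Represents-· {f = ⟦ ds ⟧ t} {⟦ ds ⟧ s} A≈t B≈s i j) (⟦⟧⋆⟦⟧ chain ps t s (toℕ i) (toℕ j))

    identity≡χ : ∀ (i j : Fin n) → identity i j ≡ χ n (toℕ i) (toℕ j)
    identity≡χ i j with toℕ i ℕ.≡ᵇ toℕ j | ℕP.≡ᵇ⇒≡ (toℕ i) (toℕ j) | ℕP.≡⇒≡ᵇ (toℕ i) (toℕ j)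
    ... | true  | ≡ᵇ⇒≡ | _    = sym (subst (λ b → χ n (toℕ i) b ≡ 1ℤ) (≡ᵇ⇒≡ _) (χ-refl n (toℕ i)))
    ... | false | _    | ≡⇒≡ᵇ = sym (χ-≢ (toℕ<n i) (toℕ<n j) ≡⇒≡ᵇ)

    Represents-shift : ∀ {A f} → Represents A f → ∀ x → Represents (shift A x) (λ a b → f a b - x * χ n a b)
    Represents-shift A≈f x i j = cong₂ (λ y z → y - x * z) (A≈f i j) (identity≡χ i j)

    eigenvalue-of-column : ∀ {A f} → Represents A f → ∀ (g : Kernel) x b →
                           (∀ a → (f ⋆ g) a b ≡ x * g a b) → ∀ {a} → a < n → g a b ≢ 0ℤ → IsEigenvalue A x
    eigenvalue-of-column A≈f g x b fg≡xg a<n gab≢0 =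
      (λ i → g (toℕ i) b) ,
      (fromℕ< a<n , subst (λ y → g y b ≢ 0ℤ) (sym (toℕ-fromℕ< a<n)) gab≢0) ,
      λ i → trans (sumFin≡sum n _)
                  (trans (sum-cong-≗ {n} (λ l → cong (_* g (toℕ l) b) (A≈f i l))) (fg≡xg (toℕ i)))

    eigenvalue-of-spectrum : ∀ {p} {ds : Vec ℕ p} → AllPairs _∣_ ds → (ps : All (_∣ n) ds) → ∀ {A t} →
                             Represents A (⟦ ds ⟧ t) → ∀ x s →
                             zipWith _*_ (spectrum ps t) (spectrum ps s) ≡ map (x *_) (spectrum ps s) →
                             ∀ {a b} → a < n → ⟦ ds ⟧ s a b ≢ 0ℤ → IsEigenvalue A x
    eigenvalue-of-spectrum {ds = ds} chain ps {t = t} A≈t x s eigen {b = b} =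
      eigenvalue-of-column {f = ⟦ ds ⟧ t} A≈t (⟦ ds ⟧ s) x b λ a → begin
        (⟦ ds ⟧ t ⋆ ⟦ ds ⟧ s) a b  ≡⟨ ⟦⟧⋆⟦⟧ chain ps t s a b ⟩
        ⟦ ds ⟧ (t ⊗⟨ ps ⟩ s) a b   ≡⟨ cong (λ u → ⟦ ds ⟧ u a b) (⊗-eigenvector ps x eigen) ⟩
        ⟦ ds ⟧ (map (x *_) s) a b  ≡⟨ ⟦⟧-scale ds x s a b ⟩
        x * ⟦ ds ⟧ s a b           ∎
      where open ≡-Reasoning

  ∈-Dlist : ∀ {d N} → d ∣ N → 0 < d → d < N → d ∈ Dlist N
  ∈-Dlist {suc d} {suc N} d∣N _ (s≤s d<N) = ∈-filter⁺ (_∣? suc N) (∈-map⁺ suc (∈-upTo⁺ d<N)) d∣N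

  ∈-Dlist⁻ : ∀ {d N} → d ∈ Dlist N → d ∣ N × d < N
  ∈-Dlist⁻ {d} {N} d∈ with ∈-filter⁻ (_∣? N) {xs = List.map suc (upTo (N ∸ 1))} d∈
  ... | d∈range , d∣N with ∈-map⁻ suc d∈range
  ... | d' , d'∈ , refl = d∣N , bound N (∈-upTo⁻ d'∈)
    where
      bound : ∀ N → d' < N ∸ 1 → suc d' < N
      bound (suc N) d'<N = s≤s d'<N

  indicator-∈ : ∀ {x L} → x ∈ L → (if does (x ∈? L) then 1ℤ else 0ℤ) ≡ 1ℤ
  indicator-∈ {x} {L} x∈L rewrite dec-true (x ∈? L) x∈L = refl

  indicator-∉ : ∀ {x L} → x ∉ L → (if does (x ∈? L) then 1ℤ else 0ℤ) ≡ 0ℤ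
  indicator-∉ {x} {L} x∉L rewrite dec-false (x ∈? L) x∉L = refl

  module ICGAdjacency (k m r : ℕ) .{{_ : NonZero k}} .{{_ : NonZero m}} .{{_ : NonZero r}} where

    km n : ℕ
    km = k ℕ.* m
    n  = k ℕ.* (m ℕ.* r)

    instance
      _ : NonZero km
      _ = ℕP.m*n≢0 k m
      _ : NonZero (m ℕ.* r)
      _ = ℕP.m*n≢0 m r
      _ : NonZero n
      _ = ℕP.m*n≢0 k (m ℕ.* r)

    D : List ℕ
    D = Dthm n k m r

    km*r≡n : km ℕ.* r ≡ n
    km*r≡n = ℕP.*-assoc k m r

    k∣km : k ∣ km
    k∣km = ∣m⇒∣m*n m ∣-refl

    k∣n : k ∣ n
    k∣n = ∣m⇒∣m*n (m ℕ.* r) ∣-refl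

    km∣n : km ∣ n
    km∣n = divides r (trans (sym km*r≡n) (ℕP.*-comm km r))

    n∉D : n ∉ D
    n∉D n∈D with ∈-++⁻ (filter (λ d → ¬? (k ∣? d)) (Dlist n)) n∈D
    ... | inj₁ n∈Dₙ =
      ℕP.<-irrefl refl (proj₂ (∈-Dlist⁻ (proj₁ (∈-filter⁻ (λ d → ¬? (k ∣? d)) {xs = Dlist n} n∈Dₙ))))
    ... | inj₂ n∈kmDᵣ with ∈-map⁻ (km ℕ.*_) n∈kmDᵣ
    ... | δ , δ∈ , n≡km*δ = ℕP.<-irrefl (sym n≡km*δ)
          (subst (km ℕ.* δ <_) km*r≡n (ℕP.*-monoʳ-< km (proj₂ (∈-Dlist⁻ δ∈))))

    module _ {s : ℕ} (0<s : 0 < s) (s<n : s < n) where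

      private
        gcd∣s : gcd s n ∣ s
        gcd∣s = gcd[m,n]∣m s n

        0<gcd : 0 < gcd s n
        0<gcd = ℕP.n≢0⇒n>0 (gcd[m,n]≢0 s n (inj₁ (ℕP.n>0⇒n≢0 0<s)))

        gcd<n : gcd s n < n
        gcd<n = ℕP.≤-<-trans (∣⇒≤ {{ℕ.>-nonZero 0<s}} gcd∣s) s<n

      gcd∈D-of-∤ : ¬ k ∣ s → gcd s n ∈ D
      gcd∈D-of-∤ k∤s = ∈-++⁺ˡ (∈-filter⁺ (λ d → ¬? (k ∣? d)) (∈-Dlist (gcd[m,n]∣n s n) 0<gcd gcd<n)
                                          (λ k∣gcd → k∤s (∣-trans k∣gcd gcd∣s)))

      gcd∈D-of-km∣ : km ∣ s → gcd s n ∈ D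
      gcd∈D-of-km∣ km∣s with gcd-greatest km∣s km∣n
      ... | divides δ gcd≡δ*km = ∈-++⁺ʳ (filter (λ d → ¬? (k ∣? d)) (Dlist n))
                                   (subst (_∈ List.map (km ℕ.*_) (Dlist r)) (sym gcd≡km*δ) (∈-map⁺ (km ℕ.*_) δ∈Dᵣ))
        where
          gcd≡km*δ : gcd s n ≡ km ℕ.* δ
          gcd≡km*δ = trans gcd≡δ*km (ℕP.*-comm δ km)
          δ∈Dᵣ : δ ∈ Dlist r
          δ∈Dᵣ = ∈-Dlist (*-cancelˡ-∣ km (subst₂ _∣_ gcd≡km*δ (sym km*r≡n) (gcd[m,n]∣n s n)))
                         (ℕP.*-cancelˡ-< km 0 δ (subst₂ _<_ (sym (ℕP.*-zeroʳ km)) gcd≡km*δ 0<gcd))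
                         (ℕP.*-cancelˡ-< km δ r (subst₂ _<_ gcd≡km*δ (sym km*r≡n) gcd<n))

      gcd∉D : k ∣ s → ¬ km ∣ s → gcd s n ∉ D
      gcd∉D k∣s km∤s gcd∈D with ∈-++⁻ (filter (λ d → ¬? (k ∣? d)) (Dlist n)) gcd∈D
      ... | inj₁ gcd∈Dₙ =
        proj₂ (∈-filter⁻ (λ d → ¬? (k ∣? d)) {xs = Dlist n} gcd∈Dₙ) (gcd-greatest k∣s k∣n)
      ... | inj₂ gcd∈kmDᵣ with ∈-map⁻ (km ℕ.*_) gcd∈kmDᵣ
      ... | δ , _ , gcd≡km*δ = km∤s (∣-trans (divides δ (trans gcd≡km*δ (ℕP.*-comm km δ))) gcd∣s)

    open KernelAlgebra n

    divisorChain : Vec ℕ 4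
    divisorChain = 1 ∷ k ∷ km ∷ n ∷ []

    adjacencyCoeffs : Vec ℤ 4
    adjacencyCoeffs = 1ℤ ∷ - 1ℤ ∷ 1ℤ ∷ - 1ℤ ∷ []

    ICGadj-entry : ∀ {a b} → a < n → b < n →
                   (if does (gcd ∣ a - b ∣ n ∈? D) then 1ℤ else 0ℤ) ≡ χ 1 a b - χ k a b + χ km a b - χ n a b
    ICGadj-entry {a} {b} a<n b<n with a ℕ.≟ b
    ... | yes refl rewrite χ-refl 1 a | χ-refl k a | χ-refl km a | χ-refl n a
                         | ℕP.∣n-n∣≡0 a | gcd-identityˡ n = indicator-∉ n∉D
    ... | no a≢b with k ∣? ∣ a - b ∣
    ...   | no k∤s rewrite χ-yes a b (1∣ ∣ a - b ∣) | χ-≢ a<n b<n a≢b | χ-no a b (k∤s ∘ ∣-trans k∣km)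
                         = indicator-∈ (gcd∈D-of-∤ (m≢n⇒0<∣m-n∣ a≢b) (∣m-n∣<o a<n b<n) k∤s)
    ...   | yes k∣s with km ∣? ∣ a - b ∣
    ...     | yes km∣s rewrite χ-yes a b (1∣ ∣ a - b ∣) | χ-≢ a<n b<n a≢b
                             = indicator-∈ (gcd∈D-of-km∣ (m≢n⇒0<∣m-n∣ a≢b) (∣m-n∣<o a<n b<n) km∣s)
    ...     | no km∤s  rewrite χ-yes a b (1∣ ∣ a - b ∣) | χ-≢ a<n b<n a≢b
                             = indicator-∉ (gcd∉D (m≢n⇒0<∣m-n∣ a≢b) (∣m-n∣<o a<n b<n) k∣s km∤s)

    ICGadj-represents : Represents (ICGadj n D) (⟦ divisorChain ⟧ adjacencyCoeffs)
    ICGadj-represents i j = trans (ICGadj-entry (toℕ<n i) (toℕ<n j)) (expand (χ 1 a b) (χ k a b) (χ km a b) (χ n a b))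
      where
        a = toℕ i
        b = toℕ j
        expand : ∀ u v w x → u - v + w - x ≡ 1ℤ * u + (- 1ℤ * v + (1ℤ * w + (- 1ℤ * x + 0ℤ)))
        expand = solve-∀

  -- Writing k, m, r with explicit offsets keeps n, q = n/k and r in constructor form, so the
  -- positivity facts below hold by computation.
  module FourEigenvalues (k₀ m₀ r₀ : ℕ) where

    k m r q : ℕ
    k = 2 ℕ.+ k₀
    m = 2 ℕ.+ m₀
    r = 2 ℕ.+ r₀
    q = m ℕ.* r

    open ICGAdjacency k m r
    open KernelAlgebra n

    cofactors : All (_∣ n) divisorChain
    cofactors = divides n (sym (ℕP.*-identityʳ n)) ∷ divides q (ℕP.*-comm k q) ∷ km∣n
              ∷ divides 1 (sym (ℕP.*-identityˡ n)) ∷ []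

    chain : AllPairs _∣_ divisorChain
    chain = (1∣ k ∷ 1∣ km ∷ 1∣ n ∷ []) ∷ (k∣km ∷ k∣n ∷ []) ∷ (km∣n ∷ []) ∷ [] ∷ []

    Adj : Matrix n
    Adj = ICGadj n D

    infixl 7 _⊗_
    _⊗_ : Vec ℤ 4 → Vec ℤ 4 → Vec ℤ 4
    t ⊗ s = t ⊗⟨ cofactors ⟩ s

    σ : Vec ℤ 4 → Vec ℤ 4
    σ = spectrum cofactors

    λ₁ λ₂ λ₃ λ₄ : ℤ
    λ₁ = + r - + q - 1ℤ
    λ₂ = - 1ℤ
    λ₃ = + r - 1ℤ
    λ₄ = + n - + q + + r - 1ℤ

    eigenvalues : Vec ℤ 4
    eigenvalues = λ₄ ∷ λ₁ ∷ λ₃ ∷ λ₂ ∷ []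

    shifted : ℤ → Vec ℤ 4
    shifted x = 1ℤ ∷ - 1ℤ ∷ 1ℤ ∷ - 1ℤ - x ∷ []

    spectrum-shifted : ∀ x → σ (shifted x) ≡ map (_- x) eigenvalues
    spectrum-shifted x =
      cong₂ _∷_ (σ₁ (+ n) (+ q) (+ r) x)
        (cong₂ _∷_ (σ₂ (+ q) (+ r) x) (cong₂ _∷_ (σ₃ (+ r) x) (cong₂ _∷_ (σ₄ x) refl)))
      where
        σ₁ : ∀ N Q R x → 1ℤ * N + (- 1ℤ * Q + (1ℤ * R + ((- 1ℤ - x) * 1ℤ + 0ℤ))) ≡ N - Q + R - 1ℤ - x
        σ₁ = solve-∀
        σ₂ : ∀ Q R x → - 1ℤ * Q + (1ℤ * R + ((- 1ℤ - x) * 1ℤ + 0ℤ)) ≡ R - Q - 1ℤ - x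
        σ₂ = solve-∀
        σ₃ : ∀ R x → 1ℤ * R + ((- 1ℤ - x) * 1ℤ + 0ℤ) ≡ R - 1ℤ - x
        σ₃ = solve-∀
        σ₄ : ∀ x → (- 1ℤ - x) * 1ℤ + 0ℤ ≡ - 1ℤ - x
        σ₄ = solve-∀

    spectrum-adjacency : σ adjacencyCoeffs ≡ eigenvalues
    spectrum-adjacency = trans (spectrum-shifted 0ℤ) (trans (map-cong ℤP.+-identityʳ _) (map-id _))

    Represents-shifted : ∀ x → Represents (shift Adj x) (⟦ divisorChain ⟧ (shifted x))
    Represents-shifted x i j =
      trans (Represents-shift {f = ⟦ divisorChain ⟧ adjacencyCoeffs} ICGadj-represents x i j)
            (shift-last (χ 1 a b) (χ k a b) (χ km a b) (χ n a b) x)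
      where
        a = toℕ i
        b = toℕ j
        shift-last : ∀ u v w y x → 1ℤ * u + (- 1ℤ * v + (1ℤ * w + (- 1ℤ * y + 0ℤ))) - x * y
                                  ≡ 1ℤ * u + (- 1ℤ * v + (1ℤ * w + ((- 1ℤ - x) * y + 0ℤ)))
        shift-last = solve-∀

    λ₁<λ₂ : λ₁ ℤ.< λ₂
    λ₁<λ₂ = ≡+suc⇒< (step (+ r) (+ (suc m₀ ℕ.* r)))
      where
        step : ∀ R Q' → - 1ℤ ≡ R - (R + Q') - 1ℤ + Q'
        step = solve-∀

    λ₂<λ₃ : λ₂ ℤ.< λ₃
    λ₂<λ₃ = ≡+suc⇒< (step (+ r))
      where
        step : ∀ R → R - 1ℤ ≡ - 1ℤ + R
        step = solve-∀

    λ₃<λ₄ : λ₃ ℤ.< λ₄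
    λ₃<λ₄ = ≡+suc⇒< (step (+ r) (+ q) (+ (suc k₀ ℕ.* q)))
      where
        step : ∀ R Q N' → Q + N' - Q + R - 1ℤ ≡ R - 1ℤ + N'
        step = solve-∀

    annihilator : Vec ℤ 4
    annihilator = shifted λ₁ ⊗ shifted λ₂ ⊗ shifted λ₃ ⊗ shifted λ₄

    spectrum-annihilator : σ annihilator ≡ 0ℤ ∷ 0ℤ ∷ 0ℤ ∷ 0ℤ ∷ []
    spectrum-annihilator = begin
      σ annihilator
        ≡⟨ spectrum-⊗⁴ (shifted λ₁) (shifted λ₂) (shifted λ₃) (shifted λ₄) ⟩
      zipWith _*_ (zipWith _*_ (zipWith _*_ (σ (shifted λ₁)) (σ (shifted λ₂))) (σ (shifted λ₃))) (σ (shifted λ₄))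
        ≡⟨ cong₂ (zipWith _*_) (cong₂ (zipWith _*_) (cong₂ (zipWith _*_) (spectrum-shifted λ₁) (spectrum-shifted λ₂))
                                                   (spectrum-shifted λ₃)) (spectrum-shifted λ₄) ⟩
      zipWith _*_ (zipWith _*_ (zipWith _*_ (θ λ₁) (θ λ₂)) (θ λ₃)) (θ λ₄)
        ≡⟨ cong₂ _∷_ (root-of-∏ λ₄ λ₁ λ₂ λ₃ λ₄ (inj₂ (inj₂ (inj₂ refl))))
          (cong₂ _∷_ (root-of-∏ λ₁ λ₁ λ₂ λ₃ λ₄ (inj₁ refl))
          (cong₂ _∷_ (root-of-∏ λ₃ λ₁ λ₂ λ₃ λ₄ (inj₂ (inj₂ (inj₁ refl))))
          (cong₂ _∷_ (root-of-∏ λ₂ λ₁ λ₂ λ₃ λ₄ (inj₂ (inj₁ refl))) refl))) ⟩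
      0ℤ ∷ 0ℤ ∷ 0ℤ ∷ 0ℤ ∷ [] ∎
      where
        open ≡-Reasoning
        θ : ℤ → Vec ℤ 4
        θ x = map (_- x) eigenvalues
        spectrum-⊗⁴ : ∀ t₁ t₂ t₃ t₄ →
          σ (t₁ ⊗ t₂ ⊗ t₃ ⊗ t₄) ≡ zipWith _*_ (zipWith _*_ (zipWith _*_ (σ t₁) (σ t₂)) (σ t₃)) (σ t₄)
        spectrum-⊗⁴ t₁ t₂ t₃ t₄ =
          trans (spectrum-⊗ cofactors _ t₄) (cong (λ v → zipWith _*_ v (σ t₄))
            (trans (spectrum-⊗ cofactors _ t₃) (cong (λ v → zipWith _*_ v (σ t₃))
              (spectrum-⊗ cofactors t₁ t₂))))

    annihilates : IsZeroMatrix (((shift Adj λ₁ · shift Adj λ₂) · shift Adj λ₃) · shift Adj λ₄)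
    annihilates i j = trans (product-represents i j) (cong (λ t → ⟦ divisorChain ⟧ t (toℕ i) (toℕ j)) annihilator≡0)
      where
        product-represents : Represents (((shift Adj λ₁ · shift Adj λ₂) · shift Adj λ₃) · shift Adj λ₄)
                                        (⟦ divisorChain ⟧ annihilator)
        product-represents =
          Represents-⊗ chain cofactors (shifted λ₁ ⊗ shifted λ₂ ⊗ shifted λ₃) (shifted λ₄)
            (Represents-⊗ chain cofactors (shifted λ₁ ⊗ shifted λ₂) (shifted λ₃)
              (Represents-⊗ chain cofactors (shifted λ₁) (shifted λ₂) (Represents-shifted λ₁) (Represents-shifted λ₂))
              (Represents-shifted λ₃))
            (Represents-shifted λ₄)
        annihilator≡0 : annihilator ≡ 0ℤ ∷ 0ℤ ∷ 0ℤ ∷ 0ℤ ∷ []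
        annihilator≡0 = spectrum-injective cofactors {annihilator} {0ℤ ∷ 0ℤ ∷ 0ℤ ∷ 0ℤ ∷ []} spectrum-annihilator

    -- The eigenvector is the column b = 0 of ⟦ divisorChain ⟧ s, where σ s vanishes off the coordinates
    -- at which σ adjacencyCoeffs equals x; its entry at 0 computes to the coefficient sum of s
    -- (k − 1, r − 1, m − 1 and 1 below).
    eigenvalue : ∀ x s → Pointwise (λ σᵢ vᵢ → σᵢ ≡ x ⊎ vᵢ ≡ 0ℤ) eigenvalues (σ s) →
                 ⟦ divisorChain ⟧ s 0 0 ≢ 0ℤ → IsEigenvalue Adj x
    eigenvalue x s supported s≢0 =
      eigenvalue-of-spectrum chain cofactors {t = adjacencyCoeffs} ICGadj-represents x s
        (trans (cong (λ v → zipWith _*_ v (σ s)) spectrum-adjacency) (zipWith-*-supported x supported))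
        {0} {0} z<s s≢0

    λ₁-eigenvalue : IsEigenvalue Adj λ₁
    λ₁-eigenvalue = eigenvalue λ₁ (- 1ℤ ∷ + k ∷ 0ℤ ∷ 0ℤ ∷ [])
      (inj₂ (cancel (+ n)) ∷ inj₁ refl ∷ inj₂ refl ∷ inj₂ refl ∷ []) (λ ())
      where
        cancel : ∀ x → - 1ℤ * x + (x + 0ℤ) ≡ 0ℤ
        cancel = solve-∀

    λ₂-eigenvalue : IsEigenvalue Adj λ₂
    λ₂-eigenvalue = eigenvalue λ₂ (0ℤ ∷ 0ℤ ∷ - 1ℤ ∷ + r ∷ [])
      (inj₂ (cong (λ y → 0ℤ + (0ℤ + y)) (cancel (+ r))) ∷ inj₂ (cong (λ y → 0ℤ + y) (cancel (+ r)))
       ∷ inj₂ (cancel (+ r)) ∷ inj₁ refl ∷ []) (λ ())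
      where
        cancel : ∀ x → - 1ℤ * x + (x * 1ℤ + 0ℤ) ≡ 0ℤ
        cancel = solve-∀

    λ₃-eigenvalue : IsEigenvalue Adj λ₃
    λ₃-eigenvalue = eigenvalue λ₃ (0ℤ ∷ - 1ℤ ∷ + m ∷ 0ℤ ∷ [])
      (inj₂ (cong (λ y → 0ℤ + y) (cancel (+ q))) ∷ inj₂ (cancel (+ q)) ∷ inj₁ refl ∷ inj₂ refl ∷ []) (λ ())
      where
        cancel : ∀ x → - 1ℤ * x + (x + 0ℤ) ≡ 0ℤ
        cancel = solve-∀

    λ₄-eigenvalue : IsEigenvalue Adj λ₄
    λ₄-eigenvalue = eigenvalue λ₄ (1ℤ ∷ 0ℤ ∷ 0ℤ ∷ 0ℤ ∷ [])
      (inj₁ refl ∷ inj₂ refl ∷ inj₂ refl ∷ inj₂ refl ∷ []) (λ ())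

    four-eigenvalues : HasExactlyFourEigenvalues Adj
    four-eigenvalues =
      λ₁ , λ₂ , λ₃ , λ₄ ,
      ℤP.<⇒≢ λ₁<λ₂ , ℤP.<⇒≢ λ₁<λ₃ , ℤP.<⇒≢ (ℤP.<-trans λ₁<λ₃ λ₃<λ₄) ,
      ℤP.<⇒≢ λ₂<λ₃ , ℤP.<⇒≢ (ℤP.<-trans λ₂<λ₃ λ₃<λ₄) , ℤP.<⇒≢ λ₃<λ₄ ,
      λ₁-eigenvalue , λ₂-eigenvalue , λ₃-eigenvalue , λ₄-eigenvalue , annihilates
      where
        λ₁<λ₃ = ℤP.<-trans λ₁<λ₂ λ₂<λ₃

  m≤m*r∸1⇒2≤r : ∀ {m r} → 2 ≤ m → m ≤ m ℕ.* r ∸ 1 → 2 ≤ r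
  m≤m*r∸1⇒2≤r {m} {zero} 2≤m m≤m*0∸1 rewrite ℕP.*-zeroʳ m with ℕP.≤-trans 2≤m m≤m*0∸1
  ... | ()
  m≤m*r∸1⇒2≤r {suc m} {suc zero} _ m≤m*1∸1 rewrite ℕP.*-identityʳ m = ⊥-elim (ℕP.<-irrefl refl m≤m*1∸1)
  m≤m*r∸1⇒2≤r {r = suc (suc _)} _ _ = s≤s (s≤s z≤n)

  ICG-four-eigenvalues : ∀ {k m r} → 2 ≤ k → 2 ≤ m → 2 ≤ r →
                         HasExactlyFourEigenvalues (ICGadj (k ℕ.* (m ℕ.* r)) (Dthm (k ℕ.* (m ℕ.* r)) k m r))
  ICG-four-eigenvalues (s≤s (s≤s {n = k₀} z≤n)) (s≤s (s≤s {n = m₀} z≤n)) (s≤s (s≤s {n = r₀} z≤n)) =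
    FourEigenvalues.four-eigenvalues k₀ m₀ r₀

open import Data.Nat using (ℕ; _≤_; _<_; _∸_; _*_)
open import Data.Nat.Divisibility using (_∣_)
open import Data.Nat.Primality using (Composite)
open import Relation.Binary.PropositionalEquality using (_≡_; refl)
open ICGSpectrum using (ICG-four-eigenvalues; m≤m*r∸1⇒2≤r)

theorem4p5 : (n k m q r : ℕ) → Composite n →
    k ∣ n → 2 ≤ k → k ≤ n ∸ 1 → n ≡ k * q →
    m ∣ q → 2 ≤ m → m ≤ q ∸ 1 → q ≡ m * r →
    HasExactlyFourEigenvalues (ICGadj n (Dthm n k m r))
theorem4p5 _ _ _ _ _ _ _ 2≤k _ refl _ 2≤m m≤q∸1 refl =
  ICG-four-eigenvalues 2≤k 2≤m (m≤m*r∸1⇒2≤r 2≤m m≤q∸1)
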